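{- Let $(G,+)$, $(H,\oplus)$ be finite groups and $m\in\mathbb{N}$ even with $2^m\le|G|^{1/4}$. Then the Unpredictable Random Signs Test with parameter $m$ (run on any $f:G\to H$) is $\big(m+1,\ \frac{m}{2^m}+\frac{1}{\binom{m}{m/2}},\ \frac1{2^m}\big)$-unpredictable.
   Context: Unpredictable Random Signs Test with parameter $m$: draw $x_1,\dots,x_m\in G$ independently and uniformly and query $f(x_1),\dots,f(x_m)$; draw signs $\sigma_1,\dots,\sigma_m\in\{+,-\}$ independently and uniformly; let $S$ be a uniformly random subset of $[m]$ of size $m/2$; query $f(y)$ where $y=\sum_{j\in S}\sigma_j x_j$ ($-b$ the inverse of $b$, increasing index order); accept iff $\bigoplus_{j\in S}\sigma_jf(x_j)=f(y)$. A distribution is $\alpha$-flat if every element has probability at most $\alpha$. A test making $q$ sequential queries is $(q,\alpha,\beta)$-unpredictable if there exist nonnegative $\alpha_1,\dots,\alpha_q$, $\beta_1,\dots,\beta_q$ with $\sum\alpha_i\le\alpha$, $\sum\beta_i\le\beta$ such that for each $i$ the conditional distribution of the $i$-th query given the previous $i-1$ queries is $\alpha_i$-flat with probability at least $1-\beta_i$ over the previous queries. -}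

module Defs where

open import Level using (0ℓ)
open import Data.Nat as ℕ using (ℕ; zero; suc; _^_; s≤s; z≤n)
open import Data.Nat.Properties as ℕP using (m^n≢0; ≤-trans; m≤m+n)
open import Data.Nat.DivMod using (_/_; m/n≤m)
open import Data.Nat.Combinatorics using (_C_; nCk+nC[k+1]≡[n+1]C[k+1])
open import Data.Fin as Fin using (Fin; toℕ)
open import Data.Fin.Properties using (all?)
open import Data.Bool using (Bool; true; false; if_then_else_)
open import Data.Vec as Vec using (Vec; []; _∷_; lookup; _∷ʳ_)
open import Data.List as List using (List; []; _∷_; length; filter; cartesianProductWith; map; concatMap)
open import Data.List.Properties using (≡-dec)
open import Data.Product using (_×_; _,_)
open import Data.Rational as ℚ using (ℚ; 0ℚ; 1ℚ)
open import Data.Rational.Properties using (_≤?_)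
open import Data.Integer using (+_)
open import Algebra.Core using (Op₁; Op₂)
open import Algebra.Structures using (IsGroup)
open import Relation.Binary.PropositionalEquality using (_≡_; subst; sym)
open import Relation.Nullary using (Dec; ¬_)
open import Relation.Nullary.Decidable using (_×-dec_)

-- Finite groups.  A finite group of order n is presented (up to
-- isomorphism) as a group structure on the carrier  Fin n  with
-- propositional equality.

record FinGroup (n : ℕ) : Set where
  field
    _∙_     : Op₂ (Fin n)
    ε       : Fin n
    _⁻¹     : Op₁ (Fin n)
    isGroup : IsGroup _≡_ _∙_ ε _⁻¹

ℕ→ℚ : ℕ → ℚ
ℕ→ℚ k = (+ k) ℚ./ 1

sumℚ : {q : ℕ} → (Fin q → ℚ) → ℚ
sumℚ {zero}  a = 0ℚ
sumℚ {suc q} a = a Fin.zero ℚ.+ sumℚ (λ i → a (Fin.suc i))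

-- Abstract (non-adaptive) randomized query test:
-- a finite sample space of equally likely outcomes (a list, each
-- entry having probability 1/length), and for each outcome the
-- sequence of q queries (into a domain Fin n) it makes, in order.

record QueryTest (n q : ℕ) : Set₁ where
  field
    Outcome : Set
    space   : List Outcome
    queries : Outcome → Vec (Fin n) q

module _ {n q : ℕ} (T : QueryTest n q) where
  open QueryTest T

  -- the i-th query (i = 0 .. q-1 ; the paper's (i+1)-th query)
  query : Fin q → Outcome → Fin n
  query i ω = lookup (queries ω) i

  prev : Fin q → Outcome → List (Fin n)
  prev i ω = List.take (toℕ i) (Vec.toList (queries ω))

  #prev : Fin q → List (Fin n) → ℕ
  #prev i p = length (filter (λ ω → ≡-dec Fin._≟_ (prev i ω) p) space)

  #prevQ : Fin q → List (Fin n) → Fin n → ℕ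
  #prevQ i p g =
    length (filter (λ ω → ≡-dec Fin._≟_ (prev i ω) p ×-dec (g Fin.≟ query i ω)) space)

  -- The conditional distribution of the i-th query given that the
  -- previous queries are p is α-flat:  for every g,
  --   Pr[ query i = g | prev i = p ] = #prevQ i p g / #prev i p ≤ α
  -- (written multiplied out by #prev i p, which is positive whenever p
  -- actually occurs, the only case in which it is used below).
  CondFlat : ℚ → Fin q → List (Fin n) → Set
  CondFlat α i p = ∀ g → ℕ→ℚ (#prevQ i p g) ℚ.≤ α ℚ.* ℕ→ℚ (#prev i p)

  condFlat? : ∀ α i p → Dec (CondFlat α i p)
  condFlat? α i p = all? (λ g → ℕ→ℚ (#prevQ i p g) ≤? α ℚ.* ℕ→ℚ (#prev i p))

  #flat : ℚ → Fin q → ℕ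
  #flat α i = length (filter (λ ω → condFlat? α i (prev i ω)) space)

  Unpredictable : ℚ → ℚ → Set
  Unpredictable α β =
    Data.Product.Σ (Fin q → ℚ) λ αs → Data.Product.Σ (Fin q → ℚ) λ βs →
      (∀ i → 0ℚ ℚ.≤ αs i) × (∀ i → 0ℚ ℚ.≤ βs i) ×
      (sumℚ αs ℚ.≤ α) × (sumℚ βs ℚ.≤ β) ×
      (∀ i → (1ℚ ℚ.- βs i) ℚ.* ℕ→ℚ (length space) ℚ.≤ ℕ→ℚ (#flat (αs i) i))

allVecs : {A : Set} → List A → (m : ℕ) → List (Vec A m)
allVecs as zero    = [] ∷ []
allVecs as (suc m) = cartesianProductWith _∷_ as (allVecs as m)

count : {m : ℕ} → Vec Bool m → ℕ
count []           = 0
count (true  ∷ bs) = suc (count bs)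
count (false ∷ bs) = count bs

-- outcomes: points x_1..x_m, signs σ_1..σ_m (true = +), and the
-- indicator vector of the subset S ⊆ [m]
record RSOutcome (n m : ℕ) : Set where
  constructor rs
  field
    xs : Vec (Fin n) m
    σs : Vec Bool m
    S  : Vec Bool m

module _ {n : ℕ} (G : FinGroup n) where
  open FinGroup G

  signed : Bool → Fin n → Fin n
  signed true  x = x
  signed false x = x ⁻¹

  signedSum : {m : ℕ} → Vec (Fin n) m → Vec Bool m → Vec Bool m → Fin n
  signedSum []       []       []           = ε
  signedSum (x ∷ xs) (s ∷ ss) (true  ∷ bs) = signed s x ∙ signedSum xs ss bs
  signedSum (x ∷ xs) (s ∷ ss) (false ∷ bs) = signedSum xs ss bs

  rsSpace : (m : ℕ) → List (RSOutcome n m)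
  rsSpace m =
    filter (λ ω → count (RSOutcome.S ω) ℕ.≟ m / 2)
      (cartesianProductWith (λ x r → rs x (Data.Product.proj₁ r) (Data.Product.proj₂ r))
        (allVecs (List.allFin n) m)
        (cartesianProductWith _,_ (allVecs (true ∷ false ∷ []) m) (allVecs (true ∷ false ∷ []) m)))

  rsQueries : {m : ℕ} → RSOutcome n m → Vec (Fin n) (suc m)
  rsQueries (rs xs σs S) = xs ∷ʳ signedSum xs σs S

  -- The test run on f : G → H.  Its query pattern does not depend on f
  -- (f only enters the acceptance predicate, recorded here for completeness).
  module _ {k : ℕ} (H : FinGroup k) (f : Fin n → Fin k) where
    private module H = FinGroup H

    signedH : Bool → Fin k → Fin k
    signedH true  a = a
    signedH false a = a H.⁻¹

    signedSumH : {m : ℕ} → Vec (Fin n) m → Vec Bool m → Vec Bool m → Fin k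
    signedSumH []       []       []           = H.ε
    signedSumH (x ∷ xs) (s ∷ ss) (true  ∷ bs) = signedH s (f x) H.∙ signedSumH xs ss bs
    signedSumH (x ∷ xs) (s ∷ ss) (false ∷ bs) = signedSumH xs ss bs

    rsAccepts : {m : ℕ} → RSOutcome n m → Set
    rsAccepts (rs xs σs S) = signedSumH xs σs S ≡ f (signedSum xs σs S)

    RandomSignsTest : (m : ℕ) → QueryTest n (suc m)
    RandomSignsTest m = record
      { Outcome = RSOutcome n m
      ; space   = rsSpace m
      ; queries = rsQueries }

nCk>0 : ∀ n k → k ℕ.≤ n → 0 ℕ.< n C k
nCk>0 n       zero    _         = ℕ.s≤s ℕ.z≤n
nCk>0 (suc n) (suc k) (s≤s k≤n) =
  subst (0 ℕ.<_) (nCk+nC[k+1]≡[n+1]C[k+1] n k)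
    (≤-trans (nCk>0 n k k≤n) (m≤m+n (n C k) (n C suc k)))

mCm/2≢0 : ∀ m → ℕ.NonZero (m C (m / 2))
mCm/2≢0 m = ℕ.>-nonZero (nCk>0 m (m / 2) (m/n≤m m 2))

alphaBound : ℕ → ℚ
alphaBound m =
  ((+ m) ℚ./ (2 ^ m)) {{m^n≢0 2 m}} ℚ.+ ((+ 1) ℚ./ (m C (m / 2))) {{mCm/2≢0 m}}

betaBound : ℕ → ℚ
betaBound m = ((+ 1) ℚ./ (2 ^ m)) {{m^n≢0 2 m}}

-- The first m queries are independent uniform points of G, so each is exactly uniform given
-- the earlier ones, and 1/|G| ≤ 1/2^m.  For the last query y = Σ_{j∈S} σ_j x_j, condition on
-- x = (x_1, …, x_m).  Signs outside S do not affect y, so it suffices to look at sign choices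
-- normalised to + outside S; there are at most 2^m·2^(m/2) of them with |S| = m/2.  Call x
-- separating if normalised choices with different subsets S always give different y.  Then y
-- determines S, so each value of y has at most 2^m preimages among the 2^m·C(m,m/2) equally
-- likely (σ, S), and the conditional distribution of y is 1/C(m,m/2)-flat.  Two signed sums
-- over different subsets coincide with probability at most 1/|G|, since some x_j occurs in only
-- one of them; hence x fails to be separating with probability at most 2^(3m)/|G| ≤ 1/2^m.
module Submission where

open import Defs
open import Data.Nat using (ℕ; suc; _^_; _≤_)
open import Data.Nat.Divisibility using (_∣_)
open import Data.Fin using (Fin)

open import Algebra.Bundles using (Group)
open import Algebra.Structures using (IsGroup)
import Algebra.Properties.CommutativeSemigroup as CommutativeSemigroupProperties
import Algebra.Properties.Group as GroupProperties
open import Data.Bool as Bool using (Bool; true; false; if_then_else_)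
open import Data.Empty using (⊥-elim)
open import Data.Fin as Fin using (toℕ; inject₁; fromℕ)
open import Data.Integer as ℤ using (+≤+)
import Data.Integer.Properties as ℤ
open import Data.List using (List; []; _∷_; _++_; map; cartesianProductWith; filter; length; allFin; take)
import Data.List.Properties as Listₚ
open import Data.List.Membership.Propositional using (_∈_)
open import Data.List.Membership.Propositional.Properties using (∈-cartesianProductWith⁺; ∈-allFin; ∈-filter⁺)
open import Data.List.Relation.Unary.All as All using (All; []; _∷_; all?)
open import Data.List.Relation.Unary.All.Properties using (¬All⇒Any¬)
open import Data.List.Relation.Unary.Any as Any using (Any; here; there)
open import Data.List.Relation.Unary.AllPairs using ([]; _∷_)
open import Data.List.Relation.Unary.Unique.Propositional using (Unique)
import Data.List.Relation.Unary.Unique.Propositional.Properties as Unique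
open import Data.Nat as ℕ using (zero; _+_; _*_; z≤n)
open import Data.Nat.Properties
open import Data.Nat.Combinatorics using (_C_; nCk+nC[k+1]≡[n+1]C[k+1])
open import Data.Nat.Divisibility using (divides)
open import Data.Nat.DivMod using (_/_; m*n/n≡m)
open import Data.Product using (_×_; _,_; proj₁; proj₂)
open import Data.Rational as ℚ using (ℚ; 0ℚ; 1ℚ; toℚᵘ)
import Data.Rational.Properties as ℚ
import Data.Rational.Unnormalised as ℚᵘ
import Data.Rational.Unnormalised.Properties as ℚᵘ
open import Data.Vec using (Vec; []; _∷_; lookup; toList; _∷ʳ_)
import Data.Vec.Properties as Vecₚ
open import Data.Vec.Relation.Binary.Equality.Cast using (cast-is-id)
open import Level using (0ℓ)
open import Relation.Nullary using (Dec; yes; no; does; ¬_; ¬?)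
open import Relation.Nullary.Decidable using (_×-dec_; decidable-stable)
open import Relation.Unary using (Decidable)
open import Relation.Unary.Properties using (U?)
open import Relation.Binary.PropositionalEquality

open CommutativeSemigroupProperties +-commutativeSemigroup using () renaming (interchange to +-interchange)
open CommutativeSemigroupProperties *-commutativeSemigroup
  using () renaming (x∙yz≈y∙xz to *-x∙yz≈y∙xz; interchange to *-interchange)

∑ : {A : Set} → List A → (A → ℕ) → ℕ
∑ []       f = 0
∑ (x ∷ xs) f = f x + ∑ xs f

infix 5 ∑
syntax ∑ xs (λ x → e) = ∑[ x ∈ xs ] e

𝟙 : ∀ {p} {P : Set p} → Dec P → ℕ
𝟙 P? = if does P? then 1 else 0

module _ {A : Set} where

  ∑-cong : ∀ (xs : List A) {f g : A → ℕ} → (∀ x → f x ≡ g x) → ∑ xs f ≡ ∑ xs g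
  ∑-cong []       f≡g = refl
  ∑-cong (x ∷ xs) f≡g = cong₂ _+_ (f≡g x) (∑-cong xs f≡g)

  ∑-mono-≤ : ∀ (xs : List A) {f g : A → ℕ} → (∀ x → f x ≤ g x) → ∑ xs f ≤ ∑ xs g
  ∑-mono-≤ []       f≤g = z≤n
  ∑-mono-≤ (x ∷ xs) f≤g = +-mono-≤ (f≤g x) (∑-mono-≤ xs f≤g)

  ∑-++ : ∀ (xs ys : List A) f → ∑ (xs ++ ys) f ≡ ∑ xs f + ∑ ys f
  ∑-++ []       ys f = refl
  ∑-++ (x ∷ xs) ys f = trans (cong (f x +_) (∑-++ xs ys f)) (sym (+-assoc (f x) _ _))

  ∑-distrib-+ : ∀ (xs : List A) f g → ∑[ x ∈ xs ] (f x + g x) ≡ ∑ xs f + ∑ xs g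
  ∑-distrib-+ []       f g = refl
  ∑-distrib-+ (x ∷ xs) f g =
    trans (cong (f x + g x +_) (∑-distrib-+ xs f g)) (+-interchange (f x) (g x) (∑ xs f) (∑ xs g))

  ∑-distribˡ-* : ∀ (xs : List A) c f → ∑[ x ∈ xs ] (c * f x) ≡ c * ∑ xs f
  ∑-distribˡ-* []       c f = sym (*-zeroʳ c)
  ∑-distribˡ-* (x ∷ xs) c f =
    trans (cong (c * f x +_) (∑-distribˡ-* xs c f)) (sym (*-distribˡ-+ c (f x) _))

  ∑-distribʳ-* : ∀ (xs : List A) c f → ∑[ x ∈ xs ] (f x * c) ≡ ∑ xs f * c
  ∑-distribʳ-* xs c f =
    trans (∑-cong xs (λ x → *-comm (f x) c)) (trans (∑-distribˡ-* xs c f) (*-comm c _))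

  ∑-const : ∀ (xs : List A) c → ∑[ _ ∈ xs ] c ≡ length xs * c
  ∑-const []       c = refl
  ∑-const (x ∷ xs) c = cong (c +_) (∑-const xs c)

  length-∑ : ∀ (xs : List A) → length xs ≡ ∑[ _ ∈ xs ] 1
  length-∑ xs = sym (trans (∑-const xs 1) (*-identityʳ _))

  ∑-zero : ∀ (xs : List A) {f} → (∀ x → f x ≡ 0) → ∑ xs f ≡ 0
  ∑-zero xs f≡0 = trans (∑-cong xs f≡0) (trans (∑-const xs 0) (*-zeroʳ (length xs)))

  ∑-zero-All : ∀ (xs : List A) {f} → All (λ x → f x ≡ 0) xs → ∑ xs f ≡ 0
  ∑-zero-All []       []           = refl
  ∑-zero-All (x ∷ xs) (fx≡0 ∷ f≡0) = cong₂ _+_ fx≡0 (∑-zero-All xs f≡0)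

  module _ {P : A → Set} (P? : Decidable P) where

    length-filter-∑ : ∀ xs → length (filter P? xs) ≡ ∑[ x ∈ xs ] 𝟙 (P? x)
    length-filter-∑ []       = refl
    length-filter-∑ (x ∷ xs) with does (P? x)
    ... | true  = cong suc (length-filter-∑ xs)
    ... | false = length-filter-∑ xs

    ∑-filter : ∀ xs f → ∑ (filter P? xs) f ≡ ∑[ x ∈ xs ] (𝟙 (P? x) * f x)
    ∑-filter []       f = refl
    ∑-filter (x ∷ xs) f with does (P? x)
    ... | true  = cong₂ _+_ (sym (+-identityʳ (f x))) (∑-filter xs f)
    ... | false = ∑-filter xs f

module _ {A B : Set} where

  ∑-map : ∀ (g : A → B) (xs : List A) f → ∑ (map g xs) f ≡ ∑[ x ∈ xs ] f (g x)
  ∑-map g []       f = refl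
  ∑-map g (x ∷ xs) f = cong (f (g x) +_) (∑-map g xs f)

  ∑-comm : ∀ (xs : List A) (ys : List B) (f : A → B → ℕ) →
           ∑[ x ∈ xs ] ∑ ys (f x) ≡ ∑[ y ∈ ys ] ∑[ x ∈ xs ] f x y
  ∑-comm []       ys f = sym (∑-zero ys (λ _ → refl))
  ∑-comm (x ∷ xs) ys f = trans (cong (∑ ys (f x) +_) (∑-comm xs ys f))
                               (sym (∑-distrib-+ ys (f x) (λ y → ∑[ x ∈ xs ] f x y)))

∑-cartesianProductWith : ∀ {A B C : Set} (g : A → B → C) xs ys f →
  ∑ (cartesianProductWith g xs ys) f ≡ ∑[ x ∈ xs ] ∑[ y ∈ ys ] f (g x y)
∑-cartesianProductWith g []       ys f = refl
∑-cartesianProductWith g (x ∷ xs) ys f =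
  trans (∑-++ (map (g x) ys) _ f) (cong₂ _+_ (∑-map (g x) ys f) (∑-cartesianProductWith g xs ys f))

length-cartesianProductWith : ∀ {A B C : Set} (g : A → B → C) xs ys →
  length (cartesianProductWith g xs ys) ≡ length xs * length ys
length-cartesianProductWith g xs ys = begin
  length (cartesianProductWith g xs ys)  ≡⟨ length-∑ (cartesianProductWith g xs ys) ⟩
  ∑ (cartesianProductWith g xs ys) _     ≡⟨ ∑-cartesianProductWith g xs ys _ ⟩
  ∑[ x ∈ xs ] ∑[ y ∈ ys ] 1              ≡⟨ ∑-cong xs (λ _ → sym (length-∑ ys)) ⟩
  ∑[ x ∈ xs ] length ys                  ≡⟨ ∑-const xs (length ys) ⟩
  length xs * length ys                  ∎
  where open ≡-Reasoning

module _ {p} {P : Set p} where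

  𝟙-yes : (P? : Dec P) → P → 𝟙 P? ≡ 1
  𝟙-yes (yes _) _ = refl
  𝟙-yes (no ¬p) p = ⊥-elim (¬p p)

  𝟙-no : (P? : Dec P) → ¬ P → 𝟙 P? ≡ 0
  𝟙-no (yes p) ¬p = ⊥-elim (¬p p)
  𝟙-no (no _)  _  = refl

  𝟙+𝟙-¬ : (P? : Dec P) → 𝟙 P? + 𝟙 (¬? P?) ≡ 1
  𝟙+𝟙-¬ (yes _) = refl
  𝟙+𝟙-¬ (no _)  = refl

module _ {p q} {P : Set p} {Q : Set q} where

  𝟙-mono : (P? : Dec P) (Q? : Dec Q) → (P → Q) → 𝟙 P? ≤ 𝟙 Q?
  𝟙-mono (yes p) Q? P⇒Q = ≤-reflexive (sym (𝟙-yes Q? (P⇒Q p)))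
  𝟙-mono (no _)  Q? P⇒Q = z≤n

  𝟙-× : (P? : Dec P) (Q? : Dec Q) → 𝟙 (P? ×-dec Q?) ≡ 𝟙 P? * 𝟙 Q?
  𝟙-× (yes _) (yes _) = refl
  𝟙-× (yes _) (no _)  = refl
  𝟙-× (no _)  _       = refl

𝟙-cong : ∀ {p q} {P : Set p} {Q : Set q} (P? : Dec P) (Q? : Dec Q) → (P → Q) → (Q → P) → 𝟙 P? ≡ 𝟙 Q?
𝟙-cong P? Q? P⇒Q Q⇒P = ≤-antisym (𝟙-mono P? Q? P⇒Q) (𝟙-mono Q? P? Q⇒P)

𝟙-≟-* : ∀ a b (f : ℕ → ℕ) → 𝟙 (a ℕ.≟ b) * f a ≤ f b
𝟙-≟-* a b f = bound (a ℕ.≟ b)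
  where
  bound : (a≟b : Dec (a ≡ b)) → 𝟙 a≟b * f a ≤ f b
  bound (yes a≡b) = ≤-reflexive (trans (*-identityˡ (f a)) (cong f a≡b))
  bound (no _)    = z≤n

module _ {A : Set} {Q : A → Set} (Q? : Decidable Q) where

  ∑-𝟙-≤1 : ∀ {xs} → Unique xs → (∀ {x y} → Q x → Q y → x ≡ y) → ∑[ x ∈ xs ] 𝟙 (Q? x) ≤ 1
  ∑-𝟙-≤1 {[]}     []           Q-unique = z≤n
  ∑-𝟙-≤1 {x ∷ xs} (x∉xs ∷ xs!) Q-unique with Q? x
  ... | yes qx = ≤-reflexive (cong suc (∑-zero-All xs
                   (All.map (λ {y} x≢y → 𝟙-no (Q? y) (λ qy → x≢y (Q-unique qx qy))) x∉xs)))
  ... | no _   = ∑-𝟙-≤1 xs! Q-unique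

  ∑-𝟙-≥1 : ∀ {xs} → Any Q xs → 1 ≤ ∑[ x ∈ xs ] 𝟙 (Q? x)
  ∑-𝟙-≥1 {x ∷ xs} (here qx) = ≤-trans (≤-reflexive (sym (𝟙-yes (Q? x) qx))) (m≤m+n _ _)
  ∑-𝟙-≥1 {x ∷ xs} (there q) = ≤-trans (∑-𝟙-≥1 q) (m≤n+m _ _)

^-/2-square : ∀ a {m} → 2 ∣ m → a ^ (m / 2) * a ^ (m / 2) ≡ a ^ m
^-/2-square a (divides q refl) = begin
  a ^ (q * 2 / 2) * a ^ (q * 2 / 2)  ≡⟨ cong (λ h → a ^ h * a ^ h) (m*n/n≡m q 2) ⟩
  a ^ q * a ^ q                      ≡⟨ ^-distribˡ-+-* a q q ⟨
  a ^ (q + q)                        ≡⟨ cong (a ^_) (trans (cong (q +_) (sym (+-identityʳ q))) (*-comm 2 q)) ⟩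
  a ^ (q * 2)                        ∎
  where open ≡-Reasoning

allBools : List Bool
allBools = true ∷ false ∷ []

∈-allBools : ∀ b → b ∈ allBools
∈-allBools true  = here refl
∈-allBools false = there (here refl)

allBools-unique : Unique allBools
allBools-unique = ((λ ()) ∷ []) ∷ [] ∷ []

module _ {A : Set} (as : List A) where

  length-allVecs : ∀ m → length (allVecs as m) ≡ length as ^ m
  length-allVecs zero    = refl
  length-allVecs (suc m) =
    trans (length-cartesianProductWith _∷_ as (allVecs as m)) (cong (length as *_) (length-allVecs m))

  ∈-allVecs : (∀ a → a ∈ as) → ∀ {m} (v : Vec A m) → v ∈ allVecs as m
  ∈-allVecs ∈as []      = here refl
  ∈-allVecs ∈as (a ∷ v) = ∈-cartesianProductWith⁺ _∷_ (∈as a) (∈-allVecs ∈as v)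

  allVecs-unique : Unique as → ∀ m → Unique (allVecs as m)
  allVecs-unique as! zero    = [] ∷ []
  allVecs-unique as! (suc m) =
    Unique.cartesianProductWith⁺ _∷_ Vecₚ.∷-injective as! (allVecs-unique as! m)

allBoolVecs : (m : ℕ) → List (Vec Bool m)
allBoolVecs m = allVecs allBools m

length-allBoolVecs : ∀ m → length (allBoolVecs m) ≡ 2 ^ m
length-allBoolVecs = length-allVecs allBools

∑-allBoolVecs-count : ∀ m k → ∑[ S ∈ allBoolVecs m ] 𝟙 (count S ℕ.≟ k) ≡ m C k
∑-allBoolVecs-count zero    zero    = refl
∑-allBoolVecs-count zero    (suc k) = refl
∑-allBoolVecs-count (suc m) zero    = begin
  ∑[ S ∈ allBoolVecs (suc m) ] 𝟙 (count S ℕ.≟ 0)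
    ≡⟨ ∑-cartesianProductWith _∷_ allBools (allBoolVecs m) (λ S → 𝟙 (count S ℕ.≟ 0)) ⟩
  (∑[ S ∈ allBoolVecs m ] 0) + ((∑[ S ∈ allBoolVecs m ] 𝟙 (count S ℕ.≟ 0)) + 0)
    ≡⟨ cong₂ _+_ (∑-zero (allBoolVecs m) (λ _ → refl)) (+-identityʳ _) ⟩
  ∑[ S ∈ allBoolVecs m ] 𝟙 (count S ℕ.≟ 0)
    ≡⟨ ∑-allBoolVecs-count m zero ⟩
  1  ∎
  where open ≡-Reasoning
∑-allBoolVecs-count (suc m) (suc k) = begin
  ∑[ S ∈ allBoolVecs (suc m) ] 𝟙 (count S ℕ.≟ suc k)
    ≡⟨ ∑-cartesianProductWith _∷_ allBools (allBoolVecs m) (λ S → 𝟙 (count S ℕ.≟ suc k)) ⟩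
  (∑[ S ∈ allBoolVecs m ] 𝟙 (count S ℕ.≟ k)) + ((∑[ S ∈ allBoolVecs m ] 𝟙 (count S ℕ.≟ suc k)) + 0)
    ≡⟨ cong₂ _+_ (∑-allBoolVecs-count m k) (trans (+-identityʳ _) (∑-allBoolVecs-count m (suc k))) ⟩
  m C k + m C suc k
    ≡⟨ nCk+nC[k+1]≡[n+1]C[k+1] m k ⟩
  suc m C suc k  ∎
  where open ≡-Reasoning

allPoints : (n m : ℕ) → List (Vec (Fin n) m)
allPoints n m = allVecs (allFin n) m

length-allFin : ∀ n → length (allFin n) ≡ n
length-allFin n = Listₚ.length-tabulate (λ i → i)

length-allPoints : ∀ n m → length (allPoints n m) ≡ n ^ m
length-allPoints n m = trans (length-allVecs (allFin n) m) (cong (_^ m) (length-allFin n))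

∑-allFin-const : ∀ n c → ∑[ _ ∈ allFin n ] c ≡ n * c
∑-allFin-const n c = trans (∑-const (allFin n) c) (cong (_* c) (length-allFin n))

∑-allFin-𝟙 : ∀ {n} (g : Fin n) → ∑[ x ∈ allFin n ] 𝟙 (g Fin.≟ x) ≡ 1
∑-allFin-𝟙 {n} g = ≤-antisym
  (∑-𝟙-≤1 (g Fin.≟_) (Unique.allFin⁺ n) (λ g≡x g≡y → trans (sym g≡x) g≡y))
  (∑-𝟙-≥1 (g Fin.≟_) (∈-allFin g))

∑-allPoints-suc : ∀ {n m} (f : Vec (Fin n) (suc m) → ℕ) →
  ∑ (allPoints n (suc m)) f ≡ ∑[ x ∈ allFin n ] ∑[ xs ∈ allPoints n m ] f (x ∷ xs)
∑-allPoints-suc {n} {m} f = ∑-cartesianProductWith _∷_ (allFin n) (allPoints n m) f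

-- The j-th coordinate is uniform and independent of the first j, so fixing it costs exactly a factor n.
∑-lookup-uniform : ∀ {n m} (j : Fin m) (g : Fin n) (φ : List (Fin n) → ℕ) →
  (∑[ xs ∈ allPoints n m ] φ (take (toℕ j) (toList xs)) * 𝟙 (g Fin.≟ lookup xs j)) * n
  ≡ ∑[ xs ∈ allPoints n m ] φ (take (toℕ j) (toList xs))
∑-lookup-uniform {n} {suc m} Fin.zero g φ = begin
  (∑[ xs ∈ allPoints n (suc m) ] φ [] * 𝟙 (g Fin.≟ lookup xs Fin.zero)) * n
    ≡⟨ cong (_* n) (∑-allPoints-suc (λ xs → φ [] * 𝟙 (g Fin.≟ lookup xs Fin.zero))) ⟩
  (∑[ x ∈ allFin n ] ∑[ xs ∈ allPoints n m ] φ [] * 𝟙 (g Fin.≟ x)) * n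
    ≡⟨ cong (_* n) (∑-cong (allFin n) (λ x → ∑-distribʳ-* (allPoints n m) (𝟙 (g Fin.≟ x)) (λ _ → φ []))) ⟩
  (∑[ x ∈ allFin n ] c * 𝟙 (g Fin.≟ x)) * n
    ≡⟨ cong (_* n) (trans (∑-distribˡ-* (allFin n) c _) (cong (c *_) (∑-allFin-𝟙 g))) ⟩
  c * 1 * n
    ≡⟨ trans (cong (_* n) (*-identityʳ c)) (*-comm c n) ⟩
  n * c
    ≡⟨ ∑-allFin-const n c ⟨
  ∑[ x ∈ allFin n ] ∑[ xs ∈ allPoints n m ] φ []
    ≡⟨ ∑-allPoints-suc {n} {m} (λ _ → φ []) ⟨
  ∑[ xs ∈ allPoints n (suc m) ] φ []  ∎
  where
  open ≡-Reasoning
  c = ∑[ xs ∈ allPoints n m ] φ []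
∑-lookup-uniform {n} {suc m} (Fin.suc j) g φ = begin
  (∑[ xs ∈ allPoints n (suc m) ] φ (prefix (Fin.suc j) xs) * 𝟙 (g Fin.≟ lookup xs (Fin.suc j))) * n
    ≡⟨ cong (_* n) (∑-allPoints-suc (λ xs → φ (prefix (Fin.suc j) xs) * 𝟙 (g Fin.≟ lookup xs (Fin.suc j)))) ⟩
  (∑[ x ∈ allFin n ] ∑[ xs ∈ allPoints n m ] φ (x ∷ prefix j xs) * 𝟙 (g Fin.≟ lookup xs j)) * n
    ≡⟨ ∑-distribʳ-* (allFin n) n _ ⟨
  ∑[ x ∈ allFin n ] ((∑[ xs ∈ allPoints n m ] φ (x ∷ prefix j xs) * 𝟙 (g Fin.≟ lookup xs j)) * n)
    ≡⟨ ∑-cong (allFin n) (λ x → ∑-lookup-uniform j g (λ l → φ (x ∷ l))) ⟩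
  ∑[ x ∈ allFin n ] ∑[ xs ∈ allPoints n m ] φ (x ∷ prefix j xs)
    ≡⟨ ∑-allPoints-suc (λ xs → φ (prefix (Fin.suc j) xs)) ⟨
  ∑[ xs ∈ allPoints n (suc m) ] φ (prefix (Fin.suc j) xs)  ∎
  where
  open ≡-Reasoning
  prefix : ∀ {k} → Fin k → Vec (Fin n) k → List (Fin n)
  prefix i xs = take (toℕ i) (toList xs)

∑-allPoints-suc-≤ : ∀ {n m} (f : Vec (Fin n) (suc m) → ℕ) →
  (∀ x → (∑[ xs ∈ allPoints n m ] f (x ∷ xs)) * n ≤ n ^ m) →
  (∑ (allPoints n (suc m)) f) * n ≤ n ^ suc m
∑-allPoints-suc-≤ {n} {m} f bound = begin
  (∑ (allPoints n (suc m)) f) * n                            ≡⟨ cong (_* n) (∑-allPoints-suc f) ⟩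
  (∑[ x ∈ allFin n ] ∑[ xs ∈ allPoints n m ] f (x ∷ xs)) * n  ≡⟨ ∑-distribʳ-* (allFin n) n _ ⟨
  ∑[ x ∈ allFin n ] (∑[ xs ∈ allPoints n m ] f (x ∷ xs)) * n  ≤⟨ ∑-mono-≤ (allFin n) bound ⟩
  ∑[ x ∈ allFin n ] n ^ m                                     ≡⟨ ∑-allFin-const n (n ^ m) ⟩
  n ^ suc m                                                   ∎
  where open ≤-Reasoning

∑-allPoints-suc-≤-head : ∀ {n m} (f : Vec (Fin n) (suc m) → ℕ) →
  (∀ xs → ∑[ x ∈ allFin n ] f (x ∷ xs) ≤ 1) →
  (∑ (allPoints n (suc m)) f) * n ≤ n ^ suc m
∑-allPoints-suc-≤-head {n} {m} f bound = begin
  (∑ (allPoints n (suc m)) f) * n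
    ≡⟨ cong (_* n) (∑-allPoints-suc f) ⟩
  (∑[ x ∈ allFin n ] ∑[ xs ∈ allPoints n m ] f (x ∷ xs)) * n
    ≡⟨ cong (_* n) (∑-comm (allFin n) (allPoints n m) _) ⟩
  (∑[ xs ∈ allPoints n m ] ∑[ x ∈ allFin n ] f (x ∷ xs)) * n
    ≤⟨ *-monoˡ-≤ n (∑-mono-≤ (allPoints n m) bound) ⟩
  (∑[ xs ∈ allPoints n m ] 1) * n
    ≡⟨ cong (_* n) (trans (sym (length-∑ (allPoints n m))) (length-allPoints n m)) ⟩
  n ^ m * n
    ≡⟨ *-comm (n ^ m) n ⟩
  n ^ suc m  ∎
  where open ≤-Reasoning

module _ {A : Set} where

  take-toList-∷ʳ-inject₁ : ∀ {m} (xs : Vec A m) y (j : Fin m) →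
                           take (toℕ (inject₁ j)) (toList (xs ∷ʳ y)) ≡ take (toℕ j) (toList xs)
  take-toList-∷ʳ-inject₁ (x ∷ xs) y Fin.zero    = refl
  take-toList-∷ʳ-inject₁ (x ∷ xs) y (Fin.suc j) = cong (x ∷_) (take-toList-∷ʳ-inject₁ xs y j)

  take-toList-∷ʳ-fromℕ : ∀ {m} (xs : Vec A m) y → take (toℕ (fromℕ m)) (toList (xs ∷ʳ y)) ≡ toList xs
  take-toList-∷ʳ-fromℕ []       y = refl
  take-toList-∷ʳ-fromℕ (x ∷ xs) y = cong (x ∷_) (take-toList-∷ʳ-fromℕ xs y)

  lookup-∷ʳ-inject₁ : ∀ {m} (xs : Vec A m) y (j : Fin m) → lookup (xs ∷ʳ y) (inject₁ j) ≡ lookup xs j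
  lookup-∷ʳ-inject₁ (x ∷ xs) y Fin.zero    = refl
  lookup-∷ʳ-inject₁ (x ∷ xs) y (Fin.suc j) = lookup-∷ʳ-inject₁ xs y j

  lookup-∷ʳ-fromℕ : ∀ {m} (xs : Vec A m) y → lookup (xs ∷ʳ y) (fromℕ m) ≡ y
  lookup-∷ʳ-fromℕ []       y = refl
  lookup-∷ʳ-fromℕ (x ∷ xs) y = lookup-∷ʳ-fromℕ xs y

1/ℕ : (d : ℕ) .{{_ : ℕ.NonZero d}} → ℚ
1/ℕ d = (ℤ.+ 1) ℚ./ d

1/ℕ-nonNeg : ∀ d .{{_ : ℕ.NonZero d}} → 0ℚ ℚ.≤ 1/ℕ d
1/ℕ-nonNeg d = ℚ.nonNegative⁻¹ _ {{ℚ.normalize-nonNeg 1 d}}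

toℚᵘ-/ : ∀ a d .{{_ : ℕ.NonZero d}} → toℚᵘ ((ℤ.+ a) ℚ./ d) ℚᵘ.≃ (ℤ.+ a) ℚᵘ./ d
toℚᵘ-/ a (suc e) = ℚ.toℚᵘ-fromℚᵘ (ℚᵘ.mkℚᵘ (ℤ.+ a) e)

ℕ→ℚ-homo-+ : ∀ a b → ℕ→ℚ (a + b) ≡ ℕ→ℚ a ℚ.+ ℕ→ℚ b
ℕ→ℚ-homo-+ a b = ℚ.toℚᵘ-injective (begin-equality
  toℚᵘ (ℕ→ℚ (a + b))
    ≃⟨ toℚᵘ-/ (a + b) 1 ⟩
  (ℤ.+ (a + b)) ℚᵘ./ 1
    ≡⟨ ℚᵘ./-cong (trans (ℤ.pos-+ a b) (sym (cong₂ ℤ._+_ (ℤ.*-identityʳ (ℤ.+ a)) (ℤ.*-identityʳ (ℤ.+ b))))) refl ⟩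
  ((ℤ.+ a) ℚᵘ./ 1) ℚᵘ.+ ((ℤ.+ b) ℚᵘ./ 1)
    ≃⟨ ℚᵘ.+-cong (toℚᵘ-/ a 1) (toℚᵘ-/ b 1) ⟨
  toℚᵘ (ℕ→ℚ a) ℚᵘ.+ toℚᵘ (ℕ→ℚ b)
    ≃⟨ ℚ.toℚᵘ-homo-+ (ℕ→ℚ a) (ℕ→ℚ b) ⟨
  toℚᵘ (ℕ→ℚ a ℚ.+ ℕ→ℚ b)  ∎)
  where open ℚᵘ.≤-Reasoning

ℕ→ℚ-mono-≤ : ∀ {a b} → a ≤ b → ℕ→ℚ a ℚ.≤ ℕ→ℚ b
ℕ→ℚ-mono-≤ {a} {b} a≤b = ℚ.toℚᵘ-cancel-≤ (begin
  toℚᵘ (ℕ→ℚ a)    ≃⟨ toℚᵘ-/ a 1 ⟩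
  (ℤ.+ a) ℚᵘ./ 1  ≤⟨ ℚᵘ.*≤* (ℤ.*-monoʳ-≤-nonNeg (ℤ.+ 1) (+≤+ a≤b)) ⟩
  (ℤ.+ b) ℚᵘ./ 1  ≃⟨ toℚᵘ-/ b 1 ⟨
  toℚᵘ (ℕ→ℚ b)    ∎)
  where open ℚᵘ.≤-Reasoning

ℕ→ℚ-*-1/ℕ : ∀ a d .{{_ : ℕ.NonZero d}} → ℕ→ℚ a ℚ.* 1/ℕ d ≡ (ℤ.+ a) ℚ./ d
ℕ→ℚ-*-1/ℕ a d@(suc _) = ℚ.toℚᵘ-injective (begin-equality
  toℚᵘ (ℕ→ℚ a ℚ.* 1/ℕ d)                   ≃⟨ ℚ.toℚᵘ-homo-* (ℕ→ℚ a) (1/ℕ d) ⟩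
  toℚᵘ (ℕ→ℚ a) ℚᵘ.* toℚᵘ (1/ℕ d)           ≃⟨ ℚᵘ.*-cong (toℚᵘ-/ a 1) (toℚᵘ-/ 1 d) ⟩
  ((ℤ.+ a) ℚᵘ./ 1) ℚᵘ.* ((ℤ.+ 1) ℚᵘ./ d)   ≡⟨ ℚᵘ./-cong (ℤ.*-identityʳ (ℤ.+ a)) (*-identityˡ d) ⟩
  (ℤ.+ a) ℚᵘ./ d                           ≃⟨ toℚᵘ-/ a d ⟨
  toℚᵘ ((ℤ.+ a) ℚ./ d)                     ∎)
  where open ℚᵘ.≤-Reasoning

ℕ→ℚ-*-1/ℕ-cancel : ∀ a d .{{_ : ℕ.NonZero d}} → ℕ→ℚ (a * d) ℚ.* 1/ℕ d ≡ ℕ→ℚ a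
ℕ→ℚ-*-1/ℕ-cancel a d@(suc _) = trans (ℕ→ℚ-*-1/ℕ (a * d) d) (ℚ.toℚᵘ-injective (begin-equality
  toℚᵘ ((ℤ.+ (a * d)) ℚ./ d)      ≃⟨ toℚᵘ-/ (a * d) d ⟩
  (ℤ.+ (a * d)) ℚᵘ./ d            ≡⟨ ℚᵘ./-cong (ℤ.pos-* a d) (sym (*-identityˡ d)) ⟩
  (ℤ.+ a ℤ.* ℤ.+ d) ℚᵘ./ (1 * d)  ≃⟨ ℚᵘ.*-cancelʳ-/ d ⟩
  (ℤ.+ a) ℚᵘ./ 1                  ≃⟨ toℚᵘ-/ a 1 ⟨
  toℚᵘ (ℕ→ℚ a)                    ∎))
  where open ℚᵘ.≤-Reasoning

module _ (d : ℕ) .{{_ : ℕ.NonZero d}} where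
  private
    δ : ℚ
    δ = 1/ℕ d
    instance
      δ-nonNeg : ℚ.NonNegative δ
      δ-nonNeg = ℚ.normalize-nonNeg 1 d

  ℕ→ℚ-≤-1/ℕ* : ∀ {a b} → a * d ≤ b → ℕ→ℚ a ℚ.≤ δ ℚ.* ℕ→ℚ b
  ℕ→ℚ-≤-1/ℕ* {a} {b} ad≤b = begin
    ℕ→ℚ a              ≡⟨ ℕ→ℚ-*-1/ℕ-cancel a d ⟨
    ℕ→ℚ (a * d) ℚ.* δ  ≤⟨ ℚ.*-monoʳ-≤-nonNeg δ (ℕ→ℚ-mono-≤ {a * d} ad≤b) ⟩
    ℕ→ℚ b ℚ.* δ        ≡⟨ ℚ.*-comm (ℕ→ℚ b) δ ⟩
    δ ℚ.* ℕ→ℚ b        ∎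
    where open ℚ.≤-Reasoning

  [1-1/ℕ]*ℕ→ℚ-≤ : ∀ {a b} → a * d ≤ b * d + a → (1ℚ ℚ.- δ) ℚ.* ℕ→ℚ a ℚ.≤ ℕ→ℚ b
  [1-1/ℕ]*ℕ→ℚ-≤ {a} {b} ad≤bd+a = begin
    (1ℚ ℚ.- δ) ℚ.* A                 ≡⟨ ℚ.*-distribʳ-+ A 1ℚ (ℚ.- δ) ⟩
    1ℚ ℚ.* A ℚ.+ ℚ.- δ ℚ.* A         ≡⟨ cong₂ ℚ._+_ (ℚ.*-identityˡ A) (sym (ℚ.neg-distribˡ-* δ A)) ⟩
    A ℚ.- δ ℚ.* A                    ≤⟨ ℚ.+-monoˡ-≤ (ℚ.- (δ ℚ.* A)) a≤b+δa ⟩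
    ℕ→ℚ b ℚ.+ δ ℚ.* A ℚ.- δ ℚ.* A    ≡⟨ ℚ.+-assoc (ℕ→ℚ b) (δ ℚ.* A) (ℚ.- (δ ℚ.* A)) ⟩
    ℕ→ℚ b ℚ.+ (δ ℚ.* A ℚ.- δ ℚ.* A)  ≡⟨ cong (ℕ→ℚ b ℚ.+_) (ℚ.+-inverseʳ (δ ℚ.* A)) ⟩
    ℕ→ℚ b ℚ.+ 0ℚ                     ≡⟨ ℚ.+-identityʳ (ℕ→ℚ b) ⟩
    ℕ→ℚ b                            ∎
    where
    open ℚ.≤-Reasoning
    A = ℕ→ℚ a
    a≤b+δa : A ℚ.≤ ℕ→ℚ b ℚ.+ δ ℚ.* A
    a≤b+δa = begin
      A                                ≡⟨ ℕ→ℚ-*-1/ℕ-cancel a d ⟨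
      ℕ→ℚ (a * d) ℚ.* δ                ≤⟨ ℚ.*-monoʳ-≤-nonNeg δ (ℕ→ℚ-mono-≤ {a * d} ad≤bd+a) ⟩
      ℕ→ℚ (b * d + a) ℚ.* δ            ≡⟨ cong (ℚ._* δ) (ℕ→ℚ-homo-+ (b * d) a) ⟩
      (ℕ→ℚ (b * d) ℚ.+ A) ℚ.* δ        ≡⟨ ℚ.*-distribʳ-+ δ (ℕ→ℚ (b * d)) A ⟩
      ℕ→ℚ (b * d) ℚ.* δ ℚ.+ A ℚ.* δ    ≡⟨ cong₂ ℚ._+_ (ℕ→ℚ-*-1/ℕ-cancel b d) (ℚ.*-comm A δ) ⟩
      ℕ→ℚ b ℚ.+ δ ℚ.* A                ∎

[1-0]*ℕ→ℚ-≤ : ∀ {a b} → a ≤ b → (1ℚ ℚ.- 0ℚ) ℚ.* ℕ→ℚ a ℚ.≤ ℕ→ℚ b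
[1-0]*ℕ→ℚ-≤ {a} a≤b = ℚ.≤-trans (ℚ.≤-reflexive (ℚ.*-identityˡ (ℕ→ℚ a))) (ℕ→ℚ-mono-≤ {a} a≤b)

withLast : (m : ℕ) → ℚ → ℚ → Fin (suc m) → ℚ
withLast zero    c L Fin.zero    = L
withLast (suc m) c L Fin.zero    = c
withLast (suc m) c L (Fin.suc i) = withLast m c L i

withLast-ind : ∀ m {c L c′ L′} (P : Fin (suc m) → ℚ → ℚ → Set) →
               (∀ j → P (inject₁ j) c c′) → P (fromℕ m) L L′ →
               ∀ i → P i (withLast m c L i) (withLast m c′ L′ i)
withLast-ind zero    P Pc PL Fin.zero    = PL
withLast-ind (suc m) P Pc PL Fin.zero    = Pc Fin.zero
withLast-ind (suc m) P Pc PL (Fin.suc i) = withLast-ind m (λ i → P (Fin.suc i)) (λ j → Pc (Fin.suc j)) PL i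

withLast-nonNeg : ∀ m {c L} → 0ℚ ℚ.≤ c → 0ℚ ℚ.≤ L → ∀ i → 0ℚ ℚ.≤ withLast m c L i
withLast-nonNeg zero    0≤c 0≤L Fin.zero    = 0≤L
withLast-nonNeg (suc m) 0≤c 0≤L Fin.zero    = 0≤c
withLast-nonNeg (suc m) 0≤c 0≤L (Fin.suc i) = withLast-nonNeg m 0≤c 0≤L i

sumℚ-withLast : ∀ m c L → sumℚ (withLast m c L) ≡ ℕ→ℚ m ℚ.* c ℚ.+ L
sumℚ-withLast zero c L = begin
  L ℚ.+ 0ℚ        ≡⟨ ℚ.+-identityʳ L ⟩
  L               ≡⟨ ℚ.+-identityˡ L ⟨
  0ℚ ℚ.+ L        ≡⟨ cong (ℚ._+ L) (ℚ.*-zeroˡ c) ⟨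
  0ℚ ℚ.* c ℚ.+ L  ∎
  where open ≡-Reasoning
sumℚ-withLast (suc m) c L = begin
  c ℚ.+ sumℚ (withLast m c L)     ≡⟨ cong (c ℚ.+_) (sumℚ-withLast m c L) ⟩
  c ℚ.+ (ℕ→ℚ m ℚ.* c ℚ.+ L)       ≡⟨ ℚ.+-assoc c (ℕ→ℚ m ℚ.* c) L ⟨
  c ℚ.+ ℕ→ℚ m ℚ.* c ℚ.+ L         ≡⟨ cong (λ x → x ℚ.+ ℕ→ℚ m ℚ.* c ℚ.+ L) (ℚ.*-identityˡ c) ⟨
  1ℚ ℚ.* c ℚ.+ ℕ→ℚ m ℚ.* c ℚ.+ L  ≡⟨ cong (ℚ._+ L) (ℚ.*-distribʳ-+ c 1ℚ (ℕ→ℚ m)) ⟨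
  (1ℚ ℚ.+ ℕ→ℚ m) ℚ.* c ℚ.+ L      ≡⟨ cong (λ x → x ℚ.* c ℚ.+ L) (ℕ→ℚ-homo-+ 1 m) ⟨
  ℕ→ℚ (suc m) ℚ.* c ℚ.+ L         ∎
  where open ≡-Reasoning

1/2^ : ℕ → ℚ
1/2^ m = 1/ℕ (2 ^ m) {{m^n≢0 2 m}}

1/centralBinomial : ℕ → ℚ
1/centralBinomial m = 1/ℕ (m C (m / 2)) {{mCm/2≢0 m}}

sumℚ-withLast-alphaBound : ∀ m → sumℚ (withLast m (1/2^ m) (1/centralBinomial m)) ≡ alphaBound m
sumℚ-withLast-alphaBound m = trans (sumℚ-withLast m (1/2^ m) (1/centralBinomial m))
  (cong (ℚ._+ 1/centralBinomial m) (ℕ→ℚ-*-1/ℕ m (2 ^ m) {{m^n≢0 2 m}}))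

sumℚ-withLast-betaBound : ∀ m → sumℚ (withLast m 0ℚ (1/2^ m)) ≡ betaBound m
sumℚ-withLast-betaBound m = trans (sumℚ-withLast m 0ℚ (1/2^ m))
  (trans (cong (ℚ._+ 1/2^ m) (ℚ.*-zeroʳ (ℕ→ℚ m))) (ℚ.+-identityˡ (1/2^ m)))

infix 4 _≟ᵥ_
_≟ᵥ_ : ∀ {m} (σ σ′ : Vec Bool m) → Dec (σ ≡ σ′)
_≟ᵥ_ = Vecₚ.≡-dec Bool._≟_

𝟙-≟ᵥ-∷ : ∀ {m} s (σ σ′ : Vec Bool m) → 𝟙 (s ∷ σ ≟ᵥ s ∷ σ′) ≡ 𝟙 (σ ≟ᵥ σ′)
𝟙-≟ᵥ-∷ s σ σ′ = 𝟙-cong (s ∷ σ ≟ᵥ s ∷ σ′) (σ ≟ᵥ σ′) Vecₚ.∷-injectiveʳ (cong (s ∷_))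

normaliseSigns : ∀ {m} → Vec Bool m → Vec Bool m → Vec Bool m
normaliseSigns []      []          = []
normaliseSigns (s ∷ σ) (true  ∷ S) = s ∷ normaliseSigns σ S
normaliseSigns (s ∷ σ) (false ∷ S) = true ∷ normaliseSigns σ S

normaliseSigns-idem : ∀ {m} (σ S : Vec Bool m) → normaliseSigns (normaliseSigns σ S) S ≡ normaliseSigns σ S
normaliseSigns-idem []      []          = refl
normaliseSigns-idem (s ∷ σ) (true  ∷ S) = cong (s ∷_) (normaliseSigns-idem σ S)
normaliseSigns-idem (s ∷ σ) (false ∷ S) = cong (true ∷_) (normaliseSigns-idem σ S)

∑-normaliseSigns-fixed : ∀ {m} (S : Vec Bool m) →
  ∑[ σ ∈ allBoolVecs m ] 𝟙 (normaliseSigns σ S ≟ᵥ σ) ≡ 2 ^ count S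
∑-normaliseSigns-fixed []          = refl
∑-normaliseSigns-fixed {suc m} (true ∷ S) = begin
  ∑[ σ ∈ allBoolVecs (suc m) ] 𝟙 (normaliseSigns σ (true ∷ S) ≟ᵥ σ)
    ≡⟨ ∑-cartesianProductWith _∷_ allBools (allBoolVecs m) _ ⟩
  ∑[ s ∈ allBools ] ∑[ σ ∈ allBoolVecs m ] 𝟙 (s ∷ normaliseSigns σ S ≟ᵥ s ∷ σ)
    ≡⟨ ∑-cong allBools (λ s → ∑-cong (allBoolVecs m) (λ σ → 𝟙-≟ᵥ-∷ s (normaliseSigns σ S) σ)) ⟩
  ∑[ s ∈ allBools ] ∑[ σ ∈ allBoolVecs m ] 𝟙 (normaliseSigns σ S ≟ᵥ σ)
    ≡⟨ ∑-const allBools (∑[ σ ∈ allBoolVecs m ] 𝟙 (normaliseSigns σ S ≟ᵥ σ)) ⟩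
  2 * (∑[ σ ∈ allBoolVecs m ] 𝟙 (normaliseSigns σ S ≟ᵥ σ))
    ≡⟨ cong (2 *_) (∑-normaliseSigns-fixed S) ⟩
  2 ^ suc (count S)  ∎
  where open ≡-Reasoning
∑-normaliseSigns-fixed {suc m} (false ∷ S) = begin
  ∑[ σ ∈ allBoolVecs (suc m) ] 𝟙 (normaliseSigns σ (false ∷ S) ≟ᵥ σ)
    ≡⟨ ∑-cartesianProductWith _∷_ allBools (allBoolVecs m) _ ⟩
  (∑[ σ ∈ allBoolVecs m ] 𝟙 (true ∷ normaliseSigns σ S ≟ᵥ true ∷ σ))
    + ((∑[ σ ∈ allBoolVecs m ] 𝟙 (true ∷ normaliseSigns σ S ≟ᵥ false ∷ σ)) + 0)
    ≡⟨ cong₂ _+_ (∑-cong (allBoolVecs m) (λ σ → 𝟙-≟ᵥ-∷ true (normaliseSigns σ S) σ))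
                 (trans (+-identityʳ _) (∑-zero (allBoolVecs m) true≢false)) ⟩
  (∑[ σ ∈ allBoolVecs m ] 𝟙 (normaliseSigns σ S ≟ᵥ σ)) + 0
    ≡⟨ trans (+-identityʳ _) (∑-normaliseSigns-fixed S) ⟩
  2 ^ count S  ∎
  where
  open ≡-Reasoning
  true≢false : ∀ σ → 𝟙 (true ∷ normaliseSigns σ S ≟ᵥ false ∷ σ) ≡ 0
  true≢false σ = 𝟙-no (true ∷ normaliseSigns σ S ≟ᵥ false ∷ σ) (λ ())

module _ {n : ℕ} (G : FinGroup n) where
  open FinGroup G
  open IsGroup isGroup using (assoc)

  group : Group 0ℓ 0ℓ
  group = record { isGroup = isGroup }

  open GroupProperties group using (∙-cancelˡ; ∙-cancelʳ; ⁻¹-injective)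

  signed-injective : ∀ s {x y} → signed G s x ≡ signed G s y → x ≡ y
  signed-injective true  = λ x≡y → x≡y
  signed-injective false = ⁻¹-injective

  ∙-signed-∙-injective : ∀ a s r {x y} → a ∙ (signed G s x ∙ r) ≡ a ∙ (signed G s y ∙ r) → x ≡ y
  ∙-signed-∙-injective a s r eq = signed-injective s (∙-cancelʳ r _ _ (∙-cancelˡ a _ _ eq))

  signedSum-normaliseSigns : ∀ {m} (xs : Vec (Fin n) m) σ S →
                             signedSum G xs (normaliseSigns σ S) S ≡ signedSum G xs σ S
  signedSum-normaliseSigns []       []      []          = refl
  signedSum-normaliseSigns (x ∷ xs) (s ∷ σ) (true  ∷ S) = cong (signed G s x ∙_) (signedSum-normaliseSigns xs σ S)
  signedSum-normaliseSigns (x ∷ xs) (s ∷ σ) (false ∷ S) = signedSum-normaliseSigns xs σ S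

  absorbHead : Bool → Bool → Fin n → Fin n → Fin n
  absorbHead true  s a x = a ∙ signed G s x
  absorbHead false s a x = a

  ∙-signedSum-∷ : ∀ {m} c s a x (xs : Vec (Fin n) m) σ S →
                  a ∙ signedSum G (x ∷ xs) (s ∷ σ) (c ∷ S) ≡ absorbHead c s a x ∙ signedSum G xs σ S
  ∙-signedSum-∷ true  s a x xs σ S = sym (assoc a (signed G s x) _)
  ∙-signedSum-∷ false s a x xs σ S = refl

  𝟙-≟-∙-signedSum-∷ : ∀ {m} c s s′ a b x (σ S σ′ S′ : Vec Bool m) (xs : Vec (Fin n) m) →
    𝟙 (a ∙ signedSum G (x ∷ xs) (s ∷ σ) (c ∷ S) Fin.≟ b ∙ signedSum G (x ∷ xs) (s′ ∷ σ′) (c ∷ S′))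
    ≡ 𝟙 (absorbHead c s a x ∙ signedSum G xs σ S Fin.≟ absorbHead c s′ b x ∙ signedSum G xs σ′ S′)
  𝟙-≟-∙-signedSum-∷ c s s′ a b x σ S σ′ S′ xs = 𝟙-cong
    (a ∙ signedSum G (x ∷ xs) (s ∷ σ) (c ∷ S) Fin.≟ b ∙ signedSum G (x ∷ xs) (s′ ∷ σ′) (c ∷ S′))
    (absorbHead c s a x ∙ signedSum G xs σ S Fin.≟ absorbHead c s′ b x ∙ signedSum G xs σ′ S′)
    (λ eq → trans (sym (∙-signedSum-∷ c s a x xs σ S)) (trans eq (∙-signedSum-∷ c s′ b x xs σ′ S′)))
    (λ eq → trans (∙-signedSum-∷ c s a x xs σ S) (trans eq (sym (∙-signedSum-∷ c s′ b x xs σ′ S′))))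

  -- Two signed sums over different subsets differ in some x_j that occurs in only one of them;
  -- for each choice of the other coordinates at most one value of x_j makes them collide.
  collisions-bound : ∀ {m} (σ S σ′ S′ : Vec Bool m) → S ≢ S′ → ∀ a b →
    (∑[ xs ∈ allPoints n m ] 𝟙 (a ∙ signedSum G xs σ S Fin.≟ b ∙ signedSum G xs σ′ S′)) * n ≤ n ^ m
  collisions-bound [] [] [] [] S≢S′ a b = ⊥-elim (S≢S′ refl)
  collisions-bound (s ∷ σ) (true ∷ S) (s′ ∷ σ′) (false ∷ S′) _ a b =
    ∑-allPoints-suc-≤-head _ λ xs →
      ∑-𝟙-≤1 (λ x → a ∙ (signed G s x ∙ signedSum G xs σ S) Fin.≟ b ∙ signedSum G xs σ′ S′)
        (Unique.allFin⁺ n) (λ eq eq′ → ∙-signed-∙-injective a s _ (trans eq (sym eq′)))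
  collisions-bound (s ∷ σ) (false ∷ S) (s′ ∷ σ′) (true ∷ S′) _ a b =
    ∑-allPoints-suc-≤-head _ λ xs →
      ∑-𝟙-≤1 (λ x → a ∙ signedSum G xs σ S Fin.≟ b ∙ (signed G s′ x ∙ signedSum G xs σ′ S′))
        (Unique.allFin⁺ n) (λ eq eq′ → ∙-signed-∙-injective b s′ _ (trans (sym eq) eq′))
  collisions-bound (s ∷ σ) (true ∷ S) (s′ ∷ σ′) (true ∷ S′) S≢S′ a b =
    ∑-allPoints-suc-≤ _ λ x → ≤-trans
      (≤-reflexive (cong (_* n) (∑-cong (allPoints n _) (𝟙-≟-∙-signedSum-∷ true s s′ a b x σ S σ′ S′))))
      (collisions-bound σ S σ′ S′ (λ S≡S′ → S≢S′ (cong (true ∷_) S≡S′)) _ _)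
  collisions-bound (s ∷ σ) (false ∷ S) (s′ ∷ σ′) (false ∷ S′) S≢S′ a b =
    ∑-allPoints-suc-≤ _ λ x → ≤-trans
      (≤-reflexive (cong (_* n) (∑-cong (allPoints n _) (𝟙-≟-∙-signedSum-∷ false s s′ a b x σ S σ′ S′))))
      (collisions-bound σ S σ′ S′ (λ S≡S′ → S≢S′ (cong (false ∷_) S≡S′)) _ _)

  collisions-bound-ε : ∀ {m} (σ S σ′ S′ : Vec Bool m) → S ≢ S′ →
    (∑[ xs ∈ allPoints n m ] 𝟙 (signedSum G xs σ S Fin.≟ signedSum G xs σ′ S′)) * n ≤ n ^ m
  collisions-bound-ε σ S σ′ S′ S≢S′ = ≤-trans
    (*-monoˡ-≤ n (∑-mono-≤ (allPoints n _) λ xs →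
      𝟙-mono (signedSum G xs σ S Fin.≟ signedSum G xs σ′ S′)
             (ε ∙ signedSum G xs σ S Fin.≟ ε ∙ signedSum G xs σ′ S′) (cong (ε ∙_))))
    (collisions-bound σ S σ′ S′ S≢S′ ε ε)

infix 4 _≟ₗ_
_≟ₗ_ : ∀ {n} (p p′ : List (Fin n)) → Dec (p ≡ p′)
_≟ₗ_ = Listₚ.≡-dec Fin._≟_

module _ {n q} (T : QueryTest n q) where
  open QueryTest T

  #prev-∑ : ∀ i p → #prev T i p ≡ ∑[ ω ∈ space ] 𝟙 (prev T i ω ≟ₗ p)
  #prev-∑ i p = length-filter-∑ (λ ω → prev T i ω ≟ₗ p) space

  #prevQ-∑ : ∀ i p g → #prevQ T i p g ≡ ∑[ ω ∈ space ] 𝟙 (prev T i ω ≟ₗ p) * 𝟙 (g Fin.≟ query T i ω)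
  #prevQ-∑ i p g = trans (length-filter-∑ (λ ω → prev T i ω ≟ₗ p ×-dec g Fin.≟ query T i ω) space)
                         (∑-cong space (λ ω → 𝟙-× (prev T i ω ≟ₗ p) (g Fin.≟ query T i ω)))

  #flat-≥ : ∀ {P : Outcome → Set} (P? : Decidable P) α i →
            (∀ ω → P ω → CondFlat T α i (prev T i ω)) → ∑[ ω ∈ space ] 𝟙 (P? ω) ≤ #flat T α i
  #flat-≥ P? α i P⇒flat = begin
    ∑[ ω ∈ space ] 𝟙 (P? ω)     ≤⟨ ∑-mono-≤ space (λ ω → 𝟙-mono (P? ω) (flat? ω) (P⇒flat ω)) ⟩
    ∑[ ω ∈ space ] 𝟙 (flat? ω)  ≡⟨ length-filter-∑ flat? space ⟨
    #flat T α i                 ∎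
    where
    open ≤-Reasoning
    flat? : Decidable (λ ω → CondFlat T α i (prev T i ω))
    flat? ω = condFlat? T α i (prev T i ω)

module RandomSigns {n k : ℕ} (G : FinGroup n) (H : FinGroup k) (f : Fin n → Fin k) (m : ℕ) where

  T : QueryTest n (suc m)
  T = RandomSignsTest G H f m

  y : Vec (Fin n) m → Vec Bool m → Vec Bool m → Fin n
  y = signedSum G

  SignChoices : List (Vec Bool m × Vec Bool m)
  SignChoices = cartesianProductWith _,_ (allBoolVecs m) (allBoolVecs m)

  𝟙-half : Vec Bool m × Vec Bool m → ℕ
  𝟙-half (σ , S) = 𝟙 (count S ℕ.≟ m / 2)

  K : ℕ
  K = ∑ SignChoices 𝟙-half

  K≡2^m*C : K ≡ 2 ^ m * (m C (m / 2))
  K≡2^m*C = begin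
    ∑ SignChoices 𝟙-half
      ≡⟨ ∑-cartesianProductWith _,_ (allBoolVecs m) (allBoolVecs m) 𝟙-half ⟩
    ∑[ σ ∈ allBoolVecs m ] ∑[ S ∈ allBoolVecs m ] 𝟙 (count S ℕ.≟ m / 2)
      ≡⟨ ∑-cong (allBoolVecs m) (λ _ → ∑-allBoolVecs-count m (m / 2)) ⟩
    ∑[ σ ∈ allBoolVecs m ] m C (m / 2)
      ≡⟨ ∑-const (allBoolVecs m) (m C (m / 2)) ⟩
    length (allBoolVecs m) * (m C (m / 2))
      ≡⟨ cong (_* (m C (m / 2))) (length-allBoolVecs m) ⟩
    2 ^ m * (m C (m / 2))  ∎
    where open ≡-Reasoning

  ∑-space : ∀ F → ∑ (rsSpace G m) F
                  ≡ ∑[ xs ∈ allPoints n m ] ∑[ r ∈ SignChoices ] 𝟙-half r * F (rs xs (proj₁ r) (proj₂ r))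
  ∑-space F = trans (∑-filter (λ ω → count (RSOutcome.S ω) ℕ.≟ m / 2) outcomes F)
                    (∑-cartesianProductWith rs′ (allPoints n m) SignChoices _)
    where
    rs′ : Vec (Fin n) m → Vec Bool m × Vec Bool m → RSOutcome n m
    rs′ xs r = rs xs (proj₁ r) (proj₂ r)
    outcomes : List (RSOutcome n m)
    outcomes = cartesianProductWith rs′ (allPoints n m) SignChoices

  ∑-space-points : ∀ F F′ → (∀ xs σ S → F (rs xs σ S) ≡ F′ xs) →
                   ∑ (rsSpace G m) F ≡ K * ∑ (allPoints n m) F′
  ∑-space-points F F′ F≡F′ = begin
    ∑ (rsSpace G m) F
      ≡⟨ ∑-space F ⟩
    ∑[ xs ∈ allPoints n m ] ∑[ r ∈ SignChoices ] 𝟙-half r * F (rs xs (proj₁ r) (proj₂ r))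
      ≡⟨ ∑-cong (allPoints n m) (λ xs → ∑-cong SignChoices λ r →
           cong (𝟙-half r *_) (F≡F′ xs (proj₁ r) (proj₂ r))) ⟩
    ∑[ xs ∈ allPoints n m ] ∑[ r ∈ SignChoices ] 𝟙-half r * F′ xs
      ≡⟨ ∑-cong (allPoints n m) (λ xs → ∑-distribʳ-* SignChoices (F′ xs) 𝟙-half) ⟩
    ∑[ xs ∈ allPoints n m ] K * F′ xs
      ≡⟨ ∑-distribˡ-* (allPoints n m) K F′ ⟩
    K * ∑ (allPoints n m) F′  ∎
    where open ≡-Reasoning

  length-space : length (rsSpace G m) ≡ K * n ^ m
  length-space = begin
    length (rsSpace G m)            ≡⟨ length-∑ (rsSpace G m) ⟩
    ∑[ _ ∈ rsSpace G m ] 1          ≡⟨ ∑-space-points (λ _ → 1) (λ _ → 1) (λ _ _ _ → refl) ⟩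
    K * (∑[ _ ∈ allPoints n m ] 1)  ≡⟨ cong (K *_) (trans (sym (length-∑ (allPoints n m))) (length-allPoints n m)) ⟩
    K * n ^ m                       ∎
    where open ≡-Reasoning

  #prevQ-inject₁ : ∀ j p g → #prevQ T (inject₁ j) p g * n ≡ #prev T (inject₁ j) p
  #prevQ-inject₁ j p g = begin
    #prevQ T (inject₁ j) p g * n
      ≡⟨ cong (_* n) (trans (#prevQ-∑ T (inject₁ j) p g) (∑-space-points _ _ prevQ-points)) ⟩
    K * (∑[ xs ∈ allPoints n m ] φ (prefix xs) * 𝟙 (g Fin.≟ lookup xs j)) * n
      ≡⟨ *-assoc K _ n ⟩
    K * ((∑[ xs ∈ allPoints n m ] φ (prefix xs) * 𝟙 (g Fin.≟ lookup xs j)) * n)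
      ≡⟨ cong (K *_) (∑-lookup-uniform j g φ) ⟩
    K * (∑[ xs ∈ allPoints n m ] φ (prefix xs))
      ≡⟨ trans (#prev-∑ T (inject₁ j) p) (∑-space-points _ _ prev-points) ⟨
    #prev T (inject₁ j) p  ∎
    where
    open ≡-Reasoning
    φ : List (Fin n) → ℕ
    φ l = 𝟙 (l ≟ₗ p)
    prefix : Vec (Fin n) m → List (Fin n)
    prefix xs = take (toℕ j) (toList xs)
    prev-points : ∀ xs σ S → 𝟙 (prev T (inject₁ j) (rs xs σ S) ≟ₗ p) ≡ φ (prefix xs)
    prev-points xs σ S = cong φ (take-toList-∷ʳ-inject₁ xs (y xs σ S) j)
    prevQ-points : ∀ xs σ S →
      𝟙 (prev T (inject₁ j) (rs xs σ S) ≟ₗ p) * 𝟙 (g Fin.≟ query T (inject₁ j) (rs xs σ S))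
      ≡ φ (prefix xs) * 𝟙 (g Fin.≟ lookup xs j)
    prevQ-points xs σ S =
      cong₂ _*_ (prev-points xs σ S) (cong (λ x → 𝟙 (g Fin.≟ x)) (lookup-∷ʳ-inject₁ xs (y xs σ S) j))

  condFlat-inject₁ : 2 ^ m ≤ n → ∀ j p → CondFlat T (1/2^ m) (inject₁ j) p
  condFlat-inject₁ 2^m≤n j p g = ℕ→ℚ-≤-1/ℕ* (2 ^ m) {{m^n≢0 2 m}} {#prevQ T (inject₁ j) p g}
    (≤-trans (*-monoʳ-≤ (#prevQ T (inject₁ j) p g) 2^m≤n) (≤-reflexive (#prevQ-inject₁ j p g)))

  #flat-inject₁ : 2 ^ m ≤ n → ∀ j → length (rsSpace G m) ≤ #flat T (1/2^ m) (inject₁ j)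
  #flat-inject₁ 2^m≤n j = ≤-trans (≤-reflexive (length-∑ (rsSpace G m)))
    (#flat-≥ T U? (1/2^ m) (inject₁ j) (λ ω _ → condFlat-inject₁ 2^m≤n j (prev T (inject₁ j) ω)))

  prev-fromℕ : ∀ xs σ S → prev T (fromℕ m) (rs xs σ S) ≡ toList xs
  prev-fromℕ xs σ S = take-toList-∷ʳ-fromℕ xs (y xs σ S)

  query-fromℕ : ∀ xs σ S → query T (fromℕ m) (rs xs σ S) ≡ y xs σ S
  query-fromℕ xs σ S = lookup-∷ʳ-fromℕ xs (y xs σ S)

  IsNormal : Vec Bool m × Vec Bool m → Set
  IsNormal (σ , S) = count S ≡ m / 2 × normaliseSigns σ S ≡ σ

  isNormal? : Decidable IsNormal
  isNormal? (σ , S) = count S ℕ.≟ m / 2 ×-dec normaliseSigns σ S ≟ᵥ σ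

  NormalChoices : List (Vec Bool m × Vec Bool m)
  NormalChoices = filter isNormal? SignChoices

  ∈-NormalChoices : ∀ σ S → count S ≡ m / 2 → (normaliseSigns σ S , S) ∈ NormalChoices
  ∈-NormalChoices σ S |S|≡h = ∈-filter⁺ isNormal?
    (∈-cartesianProductWith⁺ _,_ (∈-allVecs allBools ∈-allBools (normaliseSigns σ S))
                                  (∈-allVecs allBools ∈-allBools S))
    (|S|≡h , normaliseSigns-idem σ S)

  NormalPairs : List ((Vec Bool m × Vec Bool m) × (Vec Bool m × Vec Bool m))
  NormalPairs = cartesianProductWith _,_ NormalChoices NormalChoices

  Collision : (Vec Bool m × Vec Bool m) × (Vec Bool m × Vec Bool m) → Vec (Fin n) m → Set
  Collision ((σ , S) , (σ′ , S′)) xs = S ≢ S′ × y xs σ S ≡ y xs σ′ S′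

  collision? : ∀ t xs → Dec (Collision t xs)
  collision? ((σ , S) , (σ′ , S′)) xs = ¬? (S ≟ᵥ S′) ×-dec y xs σ S Fin.≟ y xs σ′ S′

  Separating : Vec (Fin n) m → Set
  Separating xs = All (λ t → ¬ Collision t xs) NormalPairs

  separating? : Decidable Separating
  separating? xs = all? (λ t → ¬? (collision? t xs)) NormalPairs

  separating-injective : ∀ {xs} → Separating xs → ∀ {σ S σ′ S′} → count S ≡ m / 2 → count S′ ≡ m / 2 →
                         y xs σ S ≡ y xs σ′ S′ → S ≡ S′
  separating-injective {xs} sep {σ} {S} {σ′} {S′} |S|≡h |S′|≡h y≡y′ =
    decidable-stable (S ≟ᵥ S′) λ S≢S′ →
      All.lookup sep (∈-cartesianProductWith⁺ _,_ (∈-NormalChoices σ S |S|≡h) (∈-NormalChoices σ′ S′ |S′|≡h))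
        (S≢S′ , trans (signedSum-normaliseSigns G xs σ S) (trans y≡y′ (sym (signedSum-normaliseSigns G xs σ′ S′))))

  preimages : Vec (Fin n) m → Fin n → ℕ
  preimages xs g = ∑[ r ∈ SignChoices ] 𝟙-half r * 𝟙 (g Fin.≟ y xs (proj₁ r) (proj₂ r))

  preimages-separating : ∀ {xs} → Separating xs → ∀ g → preimages xs g ≤ 2 ^ m
  preimages-separating {xs} sep g = begin
    preimages xs g
      ≡⟨ ∑-cartesianProductWith _,_ (allBoolVecs m) (allBoolVecs m)
           (λ r → 𝟙-half r * 𝟙 (g Fin.≟ y xs (proj₁ r) (proj₂ r))) ⟩
    ∑[ σ ∈ allBoolVecs m ] ∑[ S ∈ allBoolVecs m ] 𝟙 (count S ℕ.≟ m / 2) * 𝟙 (g Fin.≟ y xs σ S)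
      ≤⟨ ∑-mono-≤ (allBoolVecs m) at-most-one ⟩
    ∑[ σ ∈ allBoolVecs m ] 1
      ≡⟨ trans (sym (length-∑ (allBoolVecs m))) (length-allBoolVecs m) ⟩
    2 ^ m  ∎
    where
    open ≤-Reasoning
    at-most-one : ∀ σ → ∑[ S ∈ allBoolVecs m ] 𝟙 (count S ℕ.≟ m / 2) * 𝟙 (g Fin.≟ y xs σ S) ≤ 1
    at-most-one σ = ≤-trans
      (≤-reflexive (∑-cong (allBoolVecs m) λ S → sym (𝟙-× (count S ℕ.≟ m / 2) (g Fin.≟ y xs σ S))))
      (∑-𝟙-≤1 (λ S → count S ℕ.≟ m / 2 ×-dec g Fin.≟ y xs σ S) (allVecs-unique allBools allBools-unique m)
        λ {S} {S′} (|S|≡h , g≡y) (|S′|≡h , g≡y′) →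
          separating-injective {xs} sep {σ} {S} {σ} {S′} |S|≡h |S′|≡h (trans (sym g≡y) g≡y′))

  #prevQ-fromℕ : ∀ p g → #prevQ T (fromℕ m) p g ≡ ∑[ xs ∈ allPoints n m ] 𝟙 (toList xs ≟ₗ p) * preimages xs g
  #prevQ-fromℕ p g = begin
    #prevQ T (fromℕ m) p g
      ≡⟨ trans (#prevQ-∑ T (fromℕ m) p g) (∑-space _) ⟩
    ∑[ xs ∈ allPoints n m ] ∑[ r ∈ SignChoices ] 𝟙-half r * (𝟙 (prevᵣ xs r ≟ₗ p) * 𝟙 (g Fin.≟ queryᵣ xs r))
      ≡⟨ ∑-cong (allPoints n m) (λ xs → ∑-cong SignChoices (rearrange xs)) ⟩
    ∑[ xs ∈ allPoints n m ] ∑[ r ∈ SignChoices ] 𝟙 (toList xs ≟ₗ p) * (𝟙-half r * 𝟙 (g Fin.≟ yᵣ xs r))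
      ≡⟨ ∑-cong (allPoints n m) (λ xs → ∑-distribˡ-* SignChoices (𝟙 (toList xs ≟ₗ p)) _) ⟩
    ∑[ xs ∈ allPoints n m ] 𝟙 (toList xs ≟ₗ p) * preimages xs g  ∎
    where
    open ≡-Reasoning
    prevᵣ : Vec (Fin n) m → Vec Bool m × Vec Bool m → List (Fin n)
    prevᵣ xs r = prev T (fromℕ m) (rs xs (proj₁ r) (proj₂ r))
    queryᵣ yᵣ : Vec (Fin n) m → Vec Bool m × Vec Bool m → Fin n
    queryᵣ xs r = query T (fromℕ m) (rs xs (proj₁ r) (proj₂ r))
    yᵣ xs r = y xs (proj₁ r) (proj₂ r)
    rearrange : ∀ xs r → 𝟙-half r * (𝟙 (prevᵣ xs r ≟ₗ p) * 𝟙 (g Fin.≟ queryᵣ xs r))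
                         ≡ 𝟙 (toList xs ≟ₗ p) * (𝟙-half r * 𝟙 (g Fin.≟ yᵣ xs r))
    rearrange xs (σ , S) rewrite prev-fromℕ xs σ S | query-fromℕ xs σ S =
      *-x∙yz≈y∙xz (𝟙-half (σ , S)) (𝟙 (toList xs ≟ₗ p)) _

  #prev-fromℕ : ∀ p → #prev T (fromℕ m) p ≡ K * (∑[ xs ∈ allPoints n m ] 𝟙 (toList xs ≟ₗ p))
  #prev-fromℕ p = trans (#prev-∑ T (fromℕ m) p)
    (∑-space-points _ _ (λ xs σ S → cong (λ l → 𝟙 (l ≟ₗ p)) (prev-fromℕ xs σ S)))

  -- Only xs itself has prefix toList xs, and its at most 2^m preimages are weighed against K = 2^m·C.
  #prevQ-fromℕ-* : ∀ {xs} → Separating xs → ∀ g →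
                   #prevQ T (fromℕ m) (toList xs) g * (m C (m / 2)) ≤ #prev T (fromℕ m) (toList xs)
  #prevQ-fromℕ-* {xs} sep g = begin
    #prevQ T (fromℕ m) (toList xs) g * c
      ≡⟨ cong (_* c) (#prevQ-fromℕ (toList xs) g) ⟩
    (∑[ xs′ ∈ allPoints n m ] 𝟙 (toList xs′ ≟ₗ toList xs) * preimages xs′ g) * c
      ≡⟨ ∑-distribʳ-* (allPoints n m) c _ ⟨
    ∑[ xs′ ∈ allPoints n m ] 𝟙 (toList xs′ ≟ₗ toList xs) * preimages xs′ g * c
      ≤⟨ ∑-mono-≤ (allPoints n m) pointwise ⟩
    ∑[ xs′ ∈ allPoints n m ] K * 𝟙 (toList xs′ ≟ₗ toList xs)
      ≡⟨ trans (∑-distribˡ-* (allPoints n m) K _) (sym (#prev-fromℕ (toList xs))) ⟩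
    #prev T (fromℕ m) (toList xs)  ∎
    where
    open ≤-Reasoning
    c = m C (m / 2)
    pointwise : ∀ xs′ → 𝟙 (toList xs′ ≟ₗ toList xs) * preimages xs′ g * c
                        ≤ K * 𝟙 (toList xs′ ≟ₗ toList xs)
    pointwise xs′ with toList xs′ ≟ₗ toList xs
    ... | no _   = z≤n
    ... | yes eq with trans (sym (cast-is-id refl xs′)) (Vecₚ.toList-injective refl xs′ xs eq)
    ... | refl = begin
      1 * preimages xs′ g * c  ≡⟨ cong (_* c) (*-identityˡ (preimages xs′ g)) ⟩
      preimages xs′ g * c      ≤⟨ *-monoˡ-≤ c (preimages-separating {xs′} sep g) ⟩
      2 ^ m * c                ≡⟨ trans (sym K≡2^m*C) (sym (*-identityʳ K)) ⟩
      K * 1                    ∎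

  condFlat-fromℕ : ∀ {xs} → Separating xs → CondFlat T (1/centralBinomial m) (fromℕ m) (toList xs)
  condFlat-fromℕ {xs} sep g =
    ℕ→ℚ-≤-1/ℕ* (m C (m / 2)) {{mCm/2≢0 m}} {#prevQ T (fromℕ m) (toList xs) g} (#prevQ-fromℕ-* sep g)

  #flat-fromℕ : K * (∑[ xs ∈ allPoints n m ] 𝟙 (separating? xs)) ≤ #flat T (1/centralBinomial m) (fromℕ m)
  #flat-fromℕ = ≤-trans
    (≤-reflexive (sym (∑-space-points (λ ω → 𝟙 (separating? (RSOutcome.xs ω))) _ (λ _ _ _ → refl))))
    (#flat-≥ T (λ ω → separating? (RSOutcome.xs ω)) (1/centralBinomial m) (fromℕ m) λ where
      (rs xs σ S) sep →
        subst (CondFlat T (1/centralBinomial m) (fromℕ m)) (sym (prev-fromℕ xs σ S)) (condFlat-fromℕ {xs} sep))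

  collisions-pair-bound : ∀ t → (∑[ xs ∈ allPoints n m ] 𝟙 (collision? t xs)) * n ≤ n ^ m
  collisions-pair-bound t@((σ , S) , (σ′ , S′)) = bound (S ≟ᵥ S′)
    where
    bound : Dec (S ≡ S′) → (∑[ xs ∈ allPoints n m ] 𝟙 (collision? t xs)) * n ≤ n ^ m
    bound (yes S≡S′) = ≤-trans (≤-reflexive (cong (_* n) (∑-zero (allPoints n m)
                         λ xs → 𝟙-no (collision? t xs) (λ (S≢S′ , _) → S≢S′ S≡S′)))) z≤n
    bound (no S≢S′)  = ≤-trans (*-monoˡ-≤ n (∑-mono-≤ (allPoints n m)
                         λ xs → 𝟙-mono (collision? t xs) (y xs σ S Fin.≟ y xs σ′ S′) proj₂))
                         (collisions-bound-ε G σ S σ′ S′ S≢S′)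

  nonSeparating-* : (∑[ xs ∈ allPoints n m ] 𝟙 (¬? (separating? xs))) * n ≤ length NormalPairs * n ^ m
  nonSeparating-* = begin
    (∑[ xs ∈ allPoints n m ] 𝟙 (¬? (separating? xs))) * n
      ≤⟨ *-monoˡ-≤ n (∑-mono-≤ (allPoints n m) some-collision) ⟩
    (∑[ xs ∈ allPoints n m ] ∑[ t ∈ NormalPairs ] 𝟙 (collision? t xs)) * n
      ≡⟨ cong (_* n) (∑-comm (allPoints n m) NormalPairs _) ⟩
    (∑[ t ∈ NormalPairs ] ∑[ xs ∈ allPoints n m ] 𝟙 (collision? t xs)) * n
      ≡⟨ ∑-distribʳ-* NormalPairs n _ ⟨
    ∑[ t ∈ NormalPairs ] (∑[ xs ∈ allPoints n m ] 𝟙 (collision? t xs)) * n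
      ≤⟨ ∑-mono-≤ NormalPairs collisions-pair-bound ⟩
    ∑[ t ∈ NormalPairs ] n ^ m
      ≡⟨ ∑-const NormalPairs (n ^ m) ⟩
    length NormalPairs * n ^ m  ∎
    where
    open ≤-Reasoning
    some-collision : ∀ xs → 𝟙 (¬? (separating? xs)) ≤ ∑[ t ∈ NormalPairs ] 𝟙 (collision? t xs)
    some-collision xs with separating? xs
    ... | yes _   = z≤n
    ... | no ¬sep = ∑-𝟙-≥1 (λ t → collision? t xs) (Any.map (decidable-stable (collision? _ xs))
                      (¬All⇒Any¬ (λ t → ¬? (collision? t xs)) NormalPairs ¬sep))

  length-NormalChoices : length NormalChoices ≤ 2 ^ m * 2 ^ (m / 2)
  length-NormalChoices = begin
    length NormalChoices
      ≡⟨ length-filter-∑ isNormal? SignChoices ⟩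
    ∑ SignChoices (λ r → 𝟙 (isNormal? r))
      ≡⟨ ∑-cartesianProductWith _,_ (allBoolVecs m) (allBoolVecs m) (λ r → 𝟙 (isNormal? r)) ⟩
    ∑[ σ ∈ allBoolVecs m ] ∑[ S ∈ allBoolVecs m ] 𝟙 (isNormal? (σ , S))
      ≡⟨ ∑-comm (allBoolVecs m) (allBoolVecs m) _ ⟩
    ∑[ S ∈ allBoolVecs m ] ∑[ σ ∈ allBoolVecs m ] 𝟙 (isNormal? (σ , S))
      ≡⟨ ∑-cong (allBoolVecs m) per-subset ⟩
    ∑[ S ∈ allBoolVecs m ] 𝟙 (count S ℕ.≟ m / 2) * 2 ^ count S
      ≤⟨ ∑-mono-≤ (allBoolVecs m) (λ S → 𝟙-≟-* (count S) (m / 2) (2 ^_)) ⟩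
    ∑[ S ∈ allBoolVecs m ] 2 ^ (m / 2)
      ≡⟨ trans (∑-const (allBoolVecs m) _) (cong (_* 2 ^ (m / 2)) (length-allBoolVecs m)) ⟩
    2 ^ m * 2 ^ (m / 2)  ∎
    where
    open ≤-Reasoning
    per-subset : ∀ S → ∑[ σ ∈ allBoolVecs m ] 𝟙 (isNormal? (σ , S)) ≡ 𝟙 (count S ℕ.≟ m / 2) * 2 ^ count S
    per-subset S = begin-equality
      ∑[ σ ∈ allBoolVecs m ] 𝟙 (isNormal? (σ , S))
        ≡⟨ ∑-cong (allBoolVecs m) (λ σ → 𝟙-× (count S ℕ.≟ m / 2) (normaliseSigns σ S ≟ᵥ σ)) ⟩
      ∑[ σ ∈ allBoolVecs m ] 𝟙 (count S ℕ.≟ m / 2) * 𝟙 (normaliseSigns σ S ≟ᵥ σ)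
        ≡⟨ ∑-distribˡ-* (allBoolVecs m) (𝟙 (count S ℕ.≟ m / 2)) (λ σ → 𝟙 (normaliseSigns σ S ≟ᵥ σ)) ⟩
      𝟙 (count S ℕ.≟ m / 2) * (∑[ σ ∈ allBoolVecs m ] 𝟙 (normaliseSigns σ S ≟ᵥ σ))
        ≡⟨ cong (𝟙 (count S ℕ.≟ m / 2) *_) (∑-normaliseSigns-fixed S) ⟩
      𝟙 (count S ℕ.≟ m / 2) * 2 ^ count S  ∎

  length-NormalPairs : 2 ∣ m → length NormalPairs ≤ (2 ^ m) ^ 3
  length-NormalPairs 2∣m = begin
    length NormalPairs
      ≡⟨ length-cartesianProductWith _,_ NormalChoices NormalChoices ⟩
    length NormalChoices * length NormalChoices
      ≤⟨ *-mono-≤ length-NormalChoices length-NormalChoices ⟩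
    (t * u) * (t * u)
      ≡⟨ *-interchange t u t u ⟩
    (t * t) * (u * u)
      ≡⟨ cong (t * t *_) (^-/2-square 2 2∣m) ⟩
    t * t * t
      ≡⟨ trans (*-assoc t t t) (cong (λ v → t * (t * v)) (sym (*-identityʳ t))) ⟩
    t ^ 3  ∎
    where
    open ≤-Reasoning
    t = 2 ^ m
    u = 2 ^ (m / 2)

  nonSeparating-bound : 2 ∣ m → (2 ^ m) ^ 4 ≤ n →
                        (∑[ xs ∈ allPoints n m ] 𝟙 (¬? (separating? xs))) * 2 ^ m ≤ n ^ m
  nonSeparating-bound 2∣m t⁴≤n = *-cancelˡ-≤ (t ^ 3) {{m^n≢0 t 3 {{m^n≢0 2 m}}}} (begin
    t ^ 3 * (bad * t)           ≡⟨ trans (*-comm (t ^ 3) (bad * t)) (*-assoc bad t (t ^ 3)) ⟩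
    bad * t ^ 4                 ≤⟨ *-monoʳ-≤ bad t⁴≤n ⟩
    bad * n                     ≤⟨ nonSeparating-* ⟩
    length NormalPairs * n ^ m  ≤⟨ *-monoˡ-≤ (n ^ m) (length-NormalPairs 2∣m) ⟩
    t ^ 3 * n ^ m               ∎)
    where
    open ≤-Reasoning
    t = 2 ^ m
    bad = ∑[ xs ∈ allPoints n m ] 𝟙 (¬? (separating? xs))

  separating+nonSeparating :
    (∑[ xs ∈ allPoints n m ] 𝟙 (separating? xs)) + (∑[ xs ∈ allPoints n m ] 𝟙 (¬? (separating? xs))) ≡ n ^ m
  separating+nonSeparating = begin
    (∑[ xs ∈ allPoints n m ] 𝟙 (separating? xs)) + (∑[ xs ∈ allPoints n m ] 𝟙 (¬? (separating? xs)))
      ≡⟨ ∑-distrib-+ (allPoints n m) _ _ ⟨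
    ∑[ xs ∈ allPoints n m ] 𝟙 (separating? xs) + 𝟙 (¬? (separating? xs))
      ≡⟨ ∑-cong (allPoints n m) (λ xs → 𝟙+𝟙-¬ (separating? xs)) ⟩
    ∑[ xs ∈ allPoints n m ] 1
      ≡⟨ trans (sym (length-∑ (allPoints n m))) (length-allPoints n m) ⟩
    n ^ m  ∎
    where open ≡-Reasoning

  #flat-fromℕ-* : 2 ∣ m → (2 ^ m) ^ 4 ≤ n →
    length (rsSpace G m) * 2 ^ m ≤ #flat T (1/centralBinomial m) (fromℕ m) * 2 ^ m + length (rsSpace G m)
  #flat-fromℕ-* 2∣m t⁴≤n = begin
    length (rsSpace G m) * t
      ≡⟨ cong (_* t) (trans length-space (cong (K *_) (sym separating+nonSeparating))) ⟩
    K * (good + bad) * t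
      ≡⟨ trans (cong (_* t) (*-distribˡ-+ K good bad)) (*-distribʳ-+ t (K * good) (K * bad)) ⟩
    K * good * t + K * bad * t
      ≡⟨ cong (_+_ (K * good * t)) (*-assoc K bad t) ⟩
    K * good * t + K * (bad * t)
      ≤⟨ +-mono-≤ (*-monoˡ-≤ t #flat-fromℕ) (*-monoʳ-≤ K (nonSeparating-bound 2∣m t⁴≤n)) ⟩
    F * t + K * n ^ m
      ≡⟨ cong (_+_ (F * t)) length-space ⟨
    F * t + length (rsSpace G m)  ∎
    where
    open ≤-Reasoning
    t = 2 ^ m
    good = ∑[ xs ∈ allPoints n m ] 𝟙 (separating? xs)
    bad = ∑[ xs ∈ allPoints n m ] 𝟙 (¬? (separating? xs))
    F = #flat T (1/centralBinomial m) (fromℕ m)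

  unpredictable-inject₁ : 2 ^ m ≤ n → ∀ j →
    (1ℚ ℚ.- 0ℚ) ℚ.* ℕ→ℚ (length (rsSpace G m)) ℚ.≤ ℕ→ℚ (#flat T (1/2^ m) (inject₁ j))
  unpredictable-inject₁ 2^m≤n j = [1-0]*ℕ→ℚ-≤ (#flat-inject₁ 2^m≤n j)

  -- The implicit arguments are named in the where block: elaborated in place they make type checking very slow.
  unpredictable-fromℕ : 2 ∣ m → (2 ^ m) ^ 4 ≤ n →
    (1ℚ ℚ.- 1/2^ m) ℚ.* ℕ→ℚ (length (rsSpace G m)) ℚ.≤ ℕ→ℚ (#flat T (1/centralBinomial m) (fromℕ m))
  unpredictable-fromℕ 2∣m t⁴≤n = [1-1/ℕ]*ℕ→ℚ-≤ (2 ^ m) {{m^n≢0 2 m}} {N} {F} (#flat-fromℕ-* 2∣m t⁴≤n)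
    where
    N F : ℕ
    N = length (rsSpace G m)
    F = #flat T (1/centralBinomial m) (fromℕ m)

lemma5p5 : (n k : ℕ) (G : FinGroup n) (H : FinGroup k) (m : ℕ) →
           2 ∣ m → (2 ^ m) ^ 4 ≤ n →
           (f : Fin n → Fin k) →
           Unpredictable (RandomSignsTest G H f m) (alphaBound m) (betaBound m)
lemma5p5 n k G H m 2∣m t⁴≤n f =
  withLast m (1/2^ m) (1/centralBinomial m) , withLast m 0ℚ (1/2^ m) ,
  withLast-nonNeg m (1/ℕ-nonNeg (2 ^ m) {{m^n≢0 2 m}}) (1/ℕ-nonNeg (m C (m / 2)) {{mCm/2≢0 m}}) ,
  withLast-nonNeg m (ℚ.≤-refl {0ℚ}) (1/ℕ-nonNeg (2 ^ m) {{m^n≢0 2 m}}) ,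
  ℚ.≤-reflexive (sumℚ-withLast-alphaBound m) , ℚ.≤-reflexive (sumℚ-withLast-betaBound m) ,
  withLast-ind m (λ i α β → (1ℚ ℚ.- β) ℚ.* ℕ→ℚ (length (rsSpace G m)) ℚ.≤ ℕ→ℚ (#flat T α i))
    (unpredictable-inject₁ 2^m≤n) (unpredictable-fromℕ 2∣m t⁴≤n)
  where
  open RandomSigns G H f m
  2^m≤n : 2 ^ m ≤ n
  2^m≤n = ≤-trans (m≤m*n (2 ^ m) ((2 ^ m) ^ 3) {{m^n≢0 (2 ^ m) 3 {{m^n≢0 2 m}}}}) t⁴≤n
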